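{- Let $H$ be a simple hypergraph having no odd exact cycle. Then the edge parts incidence matrix $\mathbf B(H)$ is totally unimodular.
   Context: A hypergraph $H$ consists of a nonempty finite vertex set $V(H)$ and a finite multiset $E(H)$ of nonempty subsets of $V(H)$ (edges); $H$ is simple if it has no edges of cardinality $1$ and no repeated edges. A 2-partition of a set $e$ is an unordered pair $\{S_1,S_2\}$ of nonempty disjoint sets with union $e$; $\tau(e)$ is the set of 2-partitions of $e$ and $\tau(H)=\bigcup_{e\in E(H)}\tau(e)$. $I(H)$ is the set of all parts of all 2-partitions of all edges of $H$, together with all singletons $\{v\}$, $v\in V(H)$. The edge parts incidence matrix $\mathbf B(H)$ is the $0$-$1$ matrix with rows indexed by $I(H)$ and columns by $\tau(H)$, whose $(S,T)$ entry is $1$ iff $S\in T$. An exact walk is a sequence $S_0,e_1,S_1,\dots,e_n,S_n$ with $e_i\in E(H)$ and $\{S_{i-1},S_i\}\in\tau(e_i)$; its length is $n$. An exact cycle is an exact walk with at least three distinct edges, $S_0=S_n$, and distinct internal parts $S_1,\dots,S_{n-1}$; it is odd if its length is odd. A matrix is totally unimodular if every square submatrix has determinant $0$ or $\pm1$. -}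

module Defs where

open import Data.Nat using (ℕ; zero; suc; _≤_; _<_; _*_)
open import Data.Bool using (Bool; true; false)
import Data.Bool as Bool
open import Data.Fin using (Fin; zero; suc; toℕ; inject₁; fromℕ; punchIn)
open import Data.Fin.Subset using (Subset; _∪_; _∩_; ⊥; Nonempty; ∣_∣; ⁅_⁆)
open import Data.Vec.Properties using (≡-dec)
open import Data.Integer using (ℤ; +_; -_; -1ℤ)
import Data.Integer as ℤ
open import Data.List using (List)
open import Data.List.Membership.Propositional using (_∈_)
open import Data.List.Relation.Unary.All using (All)
open import Data.List.Relation.Unary.Unique.Propositional using (Unique)
open import Data.Product using (Σ; ∃; _×_; _,_; proj₁; proj₂)
open import Data.Sum using (_⊎_)
open import Relation.Binary.PropositionalEquality using (_≡_; _≢_)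
open import Relation.Nullary using (¬_)
open import Relation.Nullary.Decidable using (⌊_⌋; _⊎-dec_)

record Hypergraph : Set where
  field
    nV        : ℕ
    nV-pos    : 1 ≤ nV
    E         : List (Subset nV)
    E-nonempty : All Nonempty E

open Hypergraph public

Simple : Hypergraph → Set
Simple H = All (λ e → ∣ e ∣ ≢ 1) (E H) × Unique (E H)

-- 2-partitions. An unordered pair {S₁,S₂} is represented by an ordered
-- pair (S₁ , S₂); the predicate below is symmetric in S₁ and S₂.

IsTwoPartition : ∀ {n} → Subset n → Subset n → Subset n → Set
IsTwoPartition e S₁ S₂ =
  Nonempty S₁ × Nonempty S₂ × (S₁ ∩ S₂ ≡ ⊥) × (S₁ ∪ S₂ ≡ e)

UPair : ℕ → Set
UPair n = Subset n × Subset n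

SameUPair : ∀ {n} → UPair n → UPair n → Set
SameUPair (a , b) (c , d) = (a ≡ c × b ≡ d) ⊎ (a ≡ d × b ≡ c)

Inτ : (H : Hypergraph) → UPair (nV H) → Set
Inτ H (S₁ , S₂) = ∃ λ e → e ∈ E H × IsTwoPartition e S₁ S₂

InI : (H : Hypergraph) → Subset (nV H) → Set
InI H S = (∃ λ S′ → Inτ H (S , S′)) ⊎ (∃ λ v → S ≡ ⁅ v ⁆)

B-entry : ∀ {n} → Subset n → UPair n → ℤ
B-entry {n} S (T₁ , T₂) with ⌊ ≡-dec Bool._≟_ S T₁ ⊎-dec ≡-dec Bool._≟_ S T₂ ⌋
... | true  = + 1
... | false = + 0

sumFin : ∀ {k} → (Fin k → ℤ) → ℤ
sumFin {zero}  f = + 0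
sumFin {suc k} f = f zero ℤ.+ sumFin (λ i → f (suc i))

signFin : ∀ {k} → Fin k → ℤ
signFin zero    = + 1
signFin (suc i) = - signFin i

minor : ∀ {k} → Fin (suc k) → (Fin (suc k) → Fin (suc k) → ℤ) → Fin k → Fin k → ℤ
minor j M r c = M (suc r) (punchIn j c)

det : ∀ {k} → (Fin k → Fin k → ℤ) → ℤ
det {zero}  M = + 1
det {suc k} M = sumFin (λ j → signFin j ℤ.* M zero j ℤ.* det (minor j M))

BTotallyUnimodular : Hypergraph → Set
BTotallyUnimodular H =
  (k : ℕ) (r : Fin k → Subset (nV H)) (c : Fin k → UPair (nV H)) →
  (∀ i → InI H (r i)) → (∀ j → Inτ H (c j)) →
  (∀ i i′ → r i ≡ r i′ → i ≡ i′) →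
  (∀ j j′ → SameUPair (c j) (c j′) → j ≡ j′) →
  let d = det (λ i j → B-entry (r i) (c j)) in
  (d ≡ + 0) ⊎ (d ≡ + 1) ⊎ (d ≡ -1ℤ)

record ExactWalk (H : Hypergraph) : Set where
  field
    len   : ℕ
    part  : Fin (suc len) → Subset (nV H)
    edge  : Fin len → Subset (nV H)
    edge∈ : ∀ i → edge i ∈ E H
    step  : ∀ i → IsTwoPartition (edge i) (part (inject₁ i)) (part (suc i))

open ExactWalk public

IsExactCycle : ∀ {H} → ExactWalk H → Set
IsExactCycle w =
  (∃ λ i → ∃ λ j → ∃ λ l →
     edge w i ≢ edge w j × edge w i ≢ edge w l × edge w j ≢ edge w l)
  × (part w zero ≡ part w (fromℕ (len w)))
  × (∀ i j → 1 ≤ toℕ i → toℕ i < len w → 1 ≤ toℕ j → toℕ j < len w →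
       part w i ≡ part w j → i ≡ j)

IsOdd : ℕ → Set
IsOdd n = ∃ λ m → n ≡ suc (2 * m)

NoOddExactCycle : Hypergraph → Set
NoOddExactCycle H = (w : ExactWalk H) → ¬ (IsExactCycle w × IsOdd (len w))

-- A column of B(H) has its ones exactly in the rows of the two parts of its
-- 2-partition, so a square submatrix has at most two ones per column, and we
-- induct on its size.  A zero column gives determinant 0, and a column with a
-- single one gives, by Laplace expansion along it, ± the determinant of a
-- smaller submatrix of the same kind.  If every column has two ones, the
-- submatrix is the incidence matrix of a graph on its rows whose edges join the
-- two parts of a 2-partition.  An odd closed walk in that graph is an odd closed
-- exact walk of H, and a shortest one is an odd exact cycle; so the graph is
-- bipartite.  Signing the rows of the component of the first row by ±1 according
-- to their side, and all other rows by 0, gives a vanishing combination of the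
-- rows with nonzero first coefficient, hence determinant 0.

module Submission where

open import Defs

open import Level using (0ℓ)
open import Function using (_∘_; id)
open import Data.Empty using (⊥)
open import Data.Product using (Σ; ∃; _×_; _,_; proj₁; proj₂; map₁; map₂)
import Data.Product.Properties as Product
open import Data.Sum using (_⊎_; inj₁; inj₂; [_,_]′)
import Data.Sum as Sum
import Data.Bool as Bool
open import Data.Nat as ℕ
  using (ℕ; zero; suc; _∸_; _<_; _≤_; z≤n; s≤s; s≤s⁻¹; _≤′_; ≤′-refl; ≤′-step; NonZero; parity)
open import Data.Nat.Properties
  using (≤⇒≤′; n<1+n; <-trans; <-cmp; <⇒≢; <⇒≤; m<n⇒m<1+n; m≤n⇒m<n∨m≡n; ≤-<-trans; +-suc; +-assoc;
         +-identityʳ; *-suc; m+[n∸m]≡n; m∸n≤m; ∸-monoʳ-<; m<n⇒0<n∸m; anyUpTo?)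
open import Data.Nat.DivMod using (_%_; m%n<n; m<n⇒m%n≡m; n%n≡0; m%n%n≡m%n; %-distribˡ-+; [m+n]%n≡m%n)
open import Data.Nat.Induction using (<-rec)
open import Data.Parity using (Parity; 0ℙ; 1ℙ; _⁻¹) renaming (_+_ to _+ℙ_)
open import Data.Parity.Properties using (⁻¹-selfInverse; ⁻¹-involutive; suc-homo-⁻¹; +-homo-+; p+p≡0ℙ)
open import Data.Integer using (ℤ; +_; -_; _+_; _*_; -1ℤ)
import Data.Integer.Properties as ℤ
open import Data.Integer.Tactic.RingSolver using (solve-∀)
open import Algebra.Properties.Semiring.Sum ℤ.+-*-semiring
  using (sum; ∑-comm; *-distribˡ-sum; *-distribʳ-sum; sum-cong-≗; sum-replicate-zero; sum-remove)
open import Data.Fin using (Fin; zero; suc; toℕ; fromℕ<; punchIn; punchOut; lift)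
open import Data.Fin.Properties
  using (_≟_; any?; all?; ¬∀⟶∃¬; pigeonhole; punchInᵢ≢i; punchIn-punchOut; punchIn-injective;
         toℕ<n; toℕ-inject₁; toℕ-fromℕ; toℕ-fromℕ<; toℕ-injective)
open import Data.Fin.Subset using (Subset; _∩_; _∪_)
import Data.Fin.Subset as Subset
open import Data.Fin.Subset.Properties
  using (∩-comm; ∪-comm; ∩-idem; ∉⊥; ∩-abs-∪; ∩-distribˡ-∪; ∪-identityʳ)
open import Data.Vec.Properties using (≡-dec)
open import Data.Vec.Functional using (insertAt; removeAt)
open import Data.Vec.Functional.Properties using (insertAt-lookup; insertAt-punchIn; removeAt-insertAt)
open import Data.List.Membership.Propositional using (_∈_)
open import Relation.Binary using (Rel; Symmetric; Sym)
open import Relation.Binary.Definitions using (DecidableEquality; tri<; tri≈; tri>)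
open import Relation.Binary.Construct.Closure.ReflexiveTransitive using (Star; ε; _◅_; _◅◅_; gmap; reverse)
open import Relation.Binary.PropositionalEquality
open import Relation.Nullary using (¬_; Dec; yes; no; contradiction; ¬?; _×-dec_; _⊎-dec_)
open import Relation.Nullary.Decidable using (decidable-stable)
open import Relation.Unary using (Pred; Decidable; _⊆_)

-- Sums and determinants

Matrix : ℕ → Set
Matrix k = Fin k → Fin k → ℤ

sumFin≡sum : ∀ {k} (f : Fin k → ℤ) → sumFin f ≡ sum f
sumFin≡sum {zero}  f = refl
sumFin≡sum {suc k} f = cong (λ x → f zero + x) (sumFin≡sum (f ∘ suc))

det-expand : ∀ {k} (M : Matrix (suc k)) → det M ≡ sum (λ j → signFin j * M zero j * det (minor j M))
det-expand M = sumFin≡sum (λ j → signFin j * M zero j * det (minor j M))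

sum-zero : ∀ {k} {f : Fin k → ℤ} → (∀ i → f i ≡ + 0) → sum f ≡ + 0
sum-zero {k} f≡0 = trans (sum-cong-≗ f≡0) (sum-replicate-zero k)

sum-single : ∀ {k} (f : Fin (suc k) → ℤ) (i : Fin (suc k)) → (∀ l → l ≢ i → f l ≡ + 0) → sum f ≡ f i
sum-single f i others = begin
  sum f                      ≡⟨ sum-remove {i = i} f ⟩
  f i + sum (f ∘ punchIn i)  ≡⟨ cong (λ x → f i + x) (sum-zero (λ l → others _ (punchInᵢ≢i i l))) ⟩
  f i + + 0                  ≡⟨ ℤ.+-identityʳ (f i) ⟩
  f i                        ∎
  where open ≡-Reasoning

sum-pair : ∀ {k} (f : Fin (suc k) → ℤ) {a b} → a ≢ b → (∀ l → l ≢ a → l ≢ b → f l ≡ + 0) →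
           sum f ≡ f a + f b
sum-pair {zero}  f {zero} {zero} a≢b _ = contradiction refl a≢b
sum-pair {suc k} f {a} {b} a≢b others = begin
  sum f                               ≡⟨ sum-remove {i = a} f ⟩
  f a + sum (f ∘ punchIn a)           ≡⟨ cong (λ x → f a + x) (sum-single (f ∘ punchIn a) (punchOut a≢b) rest) ⟩
  f a + f (punchIn a (punchOut a≢b))  ≡⟨ cong (λ x → f a + f x) (punchIn-punchOut a≢b) ⟩
  f a + f b                           ∎
  where
  open ≡-Reasoning
  rest : ∀ l → l ≢ punchOut a≢b → f (punchIn a l) ≡ + 0
  rest l l≢ = others _ (punchInᵢ≢i a l)
    (λ eq → l≢ (punchIn-injective a _ _ (trans eq (sym (punchIn-punchOut a≢b)))))

sum-neg : ∀ {k} (f : Fin k → ℤ) → sum (λ i → - f i) ≡ - sum f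
sum-neg f = begin
  sum (λ i → - f i)      ≡⟨ sum-cong-≗ (λ i → ℤ.-1*i≡-i (f i)) ⟨
  sum (λ i → -1ℤ * f i)  ≡⟨ *-distribˡ-sum -1ℤ f ⟨
  -1ℤ * sum f            ≡⟨ ℤ.-1*i≡-i (sum f) ⟩
  - sum f                ∎
  where open ≡-Reasoning

sum-insertAt-zero : ∀ {n} (f : Fin n → ℤ) (a : Fin (suc n)) → sum (insertAt f a (+ 0)) ≡ sum f
sum-insertAt-zero f a = begin
  sum (insertAt f a (+ 0))                                      ≡⟨ sum-remove {i = a} (insertAt f a (+ 0)) ⟩
  insertAt f a (+ 0) a + sum (removeAt (insertAt f a (+ 0)) a)  ≡⟨ cong₂ _+_ (insertAt-lookup f a _)
                                                                           (sum-cong-≗ (removeAt-insertAt f a _)) ⟩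
  + 0 + sum f                                                   ≡⟨ ℤ.+-identityˡ _ ⟩
  sum f                                                         ∎
  where open ≡-Reasoning

insertAt-punchOut : ∀ {n} (f : Fin n → ℤ) {a b : Fin (suc n)} (v : ℤ) (a≢b : a ≢ b) →
                    insertAt f a v b ≡ f (punchOut a≢b)
insertAt-punchOut f {a} v a≢b = trans (cong (insertAt f a v) (sym (punchIn-punchOut a≢b))) (insertAt-punchIn f a v _)

∑-bilinear : ∀ {m n} (s : Fin m → ℤ) (X : Fin m → Fin n → ℤ) (w : Fin n → ℤ) →
             sum (λ i → s i * sum (λ j → X i j * w j)) ≡ sum (λ j → sum (λ i → s i * X i j) * w j)
∑-bilinear s X w = begin
  sum (λ i → s i * sum (λ j → X i j * w j))
    ≡⟨ sum-cong-≗ (λ i → *-distribˡ-sum (s i) (λ j → X i j * w j)) ⟩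
  sum (λ i → sum (λ j → s i * (X i j * w j)))
    ≡⟨ ∑-comm (λ i j → s i * (X i j * w j)) ⟩
  sum (λ j → sum (λ i → s i * (X i j * w j)))
    ≡⟨ sum-cong-≗ (λ j → sum-cong-≗ (λ i → ℤ.*-assoc (s i) (X i j) (w j))) ⟨
  sum (λ j → sum (λ i → s i * X i j * w j))
    ≡⟨ sum-cong-≗ (λ j → *-distribʳ-sum (w j) (λ i → s i * X i j)) ⟨
  sum (λ j → sum (λ i → s i * X i j) * w j)
    ∎
  where open ≡-Reasoning

det-cong : ∀ {k} {M N : Matrix k} → (∀ i j → M i j ≡ N i j) → det M ≡ det N
det-cong {zero}          _   = refl
det-cong {suc k} {M} {N} M≡N = begin
  det M                                               ≡⟨ det-expand M ⟩
  sum (λ j → signFin j * M zero j * det (minor j M))  ≡⟨ sum-cong-≗ term≡ ⟩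
  sum (λ j → signFin j * N zero j * det (minor j N))  ≡⟨ det-expand N ⟨
  det N                                               ∎
  where
  open ≡-Reasoning
  term≡ : ∀ j → signFin j * M zero j * det (minor j M) ≡ signFin j * N zero j * det (minor j N)
  term≡ j = cong₂ (λ x y → signFin j * x * y) (M≡N zero j) (det-cong (λ r c → M≡N (suc r) (punchIn j c)))

det-zeroColumn : ∀ {k} (M : Matrix k) (j : Fin k) → (∀ i → M i j ≡ + 0) → det M ≡ + 0
det-zeroColumn {suc k} M j col≡0 = trans (det-expand M) (sum-zero term≡0)
  where
  term≡0 : ∀ l → signFin l * M zero l * det (minor l M) ≡ + 0
  term≡0 l with l ≟ j
  ... | yes refl rewrite col≡0 zero | ℤ.*-zeroʳ (signFin l) = ℤ.*-zeroˡ (det (minor l M))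
  ... | no l≢j   rewrite det-zeroColumn (minor l M) (punchOut l≢j)
                           (λ i → trans (cong (M (suc i)) (punchIn-punchOut l≢j)) (col≡0 (suc i)))
                 = ℤ.*-zeroʳ (signFin l * M zero l)

swap01 : ∀ {n} → Fin (suc (suc n)) → Fin (suc (suc n))
swap01 zero          = suc zero
swap01 (suc zero)    = zero
swap01 (suc (suc r)) = suc (suc r)

signFin-punchOut-antisym : ∀ {n} {a b : Fin (suc (suc n))} (a≢b : a ≢ b) (b≢a : b ≢ a) →
                           signFin b * signFin (punchOut b≢a) ≡ - (signFin a * signFin (punchOut a≢b))
signFin-punchOut-antisym {a = zero}  {zero}  a≢b _ = contradiction refl a≢b
signFin-punchOut-antisym {a = zero}  {suc b} _   _ = -x*1≡-[1*x] (signFin b)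
  where
  -x*1≡-[1*x] : ∀ x → - x * + 1 ≡ - (+ 1 * x)
  -x*1≡-[1*x] = solve-∀
signFin-punchOut-antisym {a = suc a} {zero}  _   _ = 1*x≡-[-x*1] (signFin a)
  where
  1*x≡-[-x*1] : ∀ x → + 1 * x ≡ - (- x * + 1)
  1*x≡-[-x*1] = solve-∀
signFin-punchOut-antisym {zero}  {suc zero} {suc zero} a≢b _ = contradiction refl a≢b
signFin-punchOut-antisym {suc n} {suc a} {suc b} a≢b b≢a = begin
  - signFin b * - signFin pba      ≡⟨ -x*-y≡x*y (signFin b) (signFin pba) ⟩
  signFin b * signFin pba          ≡⟨ signFin-punchOut-antisym (a≢b ∘ cong suc) (b≢a ∘ cong suc) ⟩
  - (signFin a * signFin pab)      ≡⟨ cong -_ (-x*-y≡x*y (signFin a) (signFin pab)) ⟨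
  - (- signFin a * - signFin pab)  ∎
  where
  open ≡-Reasoning
  pab = punchOut (a≢b ∘ cong suc)
  pba = punchOut (b≢a ∘ cong suc)
  -x*-y≡x*y : ∀ x y → - x * - y ≡ x * y
  -x*-y≡x*y = solve-∀

punchIn-punchOut-comm : ∀ {n} {a b : Fin (suc (suc n))} (a≢b : a ≢ b) (b≢a : b ≢ a) (c : Fin n) →
                        punchIn a (punchIn (punchOut a≢b) c) ≡ punchIn b (punchIn (punchOut b≢a) c)
punchIn-punchOut-comm {a = zero}  {zero}  a≢b _ _ = contradiction refl a≢b
punchIn-punchOut-comm {a = zero}  {suc b} _   _ _ = refl
punchIn-punchOut-comm {a = suc a} {zero}  _   _ _ = refl
punchIn-punchOut-comm {suc n} {suc a} {suc b} _   _   zero    = refl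
punchIn-punchOut-comm {suc n} {suc a} {suc b} a≢b b≢a (suc c) =
  cong suc (punchIn-punchOut-comm (a≢b ∘ cong suc) (b≢a ∘ cong suc) c)

pairTerm : ∀ {n} → Matrix (suc (suc n)) → Fin (suc (suc n)) → Fin (suc n) → ℤ
pairTerm M a l = signFin a * signFin l * (M zero a * (M (suc zero) (punchIn a l) * det (minor l (minor a M))))

-- The term of the expansion along rows 0 and 1 in which these rows use
-- columns a and b; it is 0 for a = b, so the double sum runs over all pairs and
-- can be reindexed by swapping a and b.
pairExpansion : ∀ {n} → Matrix (suc (suc n)) → Fin (suc (suc n)) → Fin (suc (suc n)) → ℤ
pairExpansion M a = insertAt (pairTerm M a) a (+ 0)

det-pairExpand : ∀ {n} (M : Matrix (suc (suc n))) → det M ≡ sum (λ a → sum (pairExpansion M a))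
det-pairExpand M = begin
  det M                                               ≡⟨ det-expand M ⟩
  sum (λ a → signFin a * M zero a * det (minor a M))  ≡⟨ sum-cong-≗ expandMinor ⟩
  sum (λ a → sum (pairTerm M a))                      ≡⟨ sum-cong-≗ (λ a → sum-insertAt-zero (pairTerm M a) a) ⟨
  sum (λ a → sum (pairExpansion M a))                 ∎
  where
  open ≡-Reasoning
  reassoc : ∀ sa ma sl mb d → sa * ma * (sl * mb * d) ≡ sa * sl * (ma * (mb * d))
  reassoc = solve-∀
  expandMinor : ∀ a → signFin a * M zero a * det (minor a M) ≡ sum (pairTerm M a)
  expandMinor a = begin
    signFin a * M zero a * det (minor a M)
      ≡⟨ cong (λ x → signFin a * M zero a * x) (det-expand (minor a M)) ⟩
    signFin a * M zero a * sum (λ l → signFin l * minor a M zero l * det (minor l (minor a M)))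
      ≡⟨ *-distribˡ-sum (signFin a * M zero a) (λ l → signFin l * minor a M zero l * det (minor l (minor a M))) ⟩
    sum (λ l → signFin a * M zero a * (signFin l * minor a M zero l * det (minor l (minor a M))))
      ≡⟨ sum-cong-≗ (λ l → reassoc (signFin a) (M zero a) (signFin l) (minor a M zero l)
                                   (det (minor l (minor a M)))) ⟩
    sum (pairTerm M a)
      ∎

pairExpansion-offDiagonal : ∀ {n} (M : Matrix (suc (suc n))) {a b} (a≢b : a ≢ b) →
  pairExpansion M a b ≡ signFin a * signFin (punchOut a≢b) *
    (M zero a * (M (suc zero) b * det (λ r c → M (suc (suc r)) (punchIn a (punchIn (punchOut a≢b) c)))))
pairExpansion-offDiagonal M {a} a≢b = trans (insertAt-punchOut (pairTerm M a) (+ 0) a≢b) (cong term (punchIn-punchOut a≢b))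
  where
  term : Fin _ → ℤ
  term x = signFin a * signFin (punchOut a≢b) * (M zero a * (M (suc zero) x * det (minor (punchOut a≢b) (minor a M))))

pairExpansion-swap01 : ∀ {n} (M : Matrix (suc (suc n))) a b → pairExpansion (M ∘ swap01) b a ≡ - pairExpansion M a b
pairExpansion-swap01 M a b with a ≟ b
... | yes refl = trans (insertAt-lookup _ a _) (cong -_ (sym (insertAt-lookup _ a _)))
... | no a≢b = begin
  pairExpansion (M ∘ swap01) b a
    ≡⟨ pairExpansion-offDiagonal (M ∘ swap01) b≢a ⟩
  signFin b * signFin (punchOut b≢a) * (M (suc zero) b * (M zero a * det (rest b≢a)))
    ≡⟨ cong₂ (λ s d → s * (M (suc zero) b * (M zero a * d)))
             (signFin-punchOut-antisym a≢b b≢a)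
             (det-cong (λ r c → cong (M (suc (suc r))) (sym (punchIn-punchOut-comm a≢b b≢a c)))) ⟩
  - (signFin a * signFin (punchOut a≢b)) * (M (suc zero) b * (M zero a * det (rest a≢b)))
    ≡⟨ reassoc (signFin a * signFin (punchOut a≢b)) (M zero a) (M (suc zero) b) (det (rest a≢b)) ⟩
  - (signFin a * signFin (punchOut a≢b) * (M zero a * (M (suc zero) b * det (rest a≢b))))
    ≡⟨ cong -_ (pairExpansion-offDiagonal M a≢b) ⟨
  - pairExpansion M a b
    ∎
  where
  open ≡-Reasoning
  b≢a = a≢b ∘ sym
  rest : ∀ {a b} → a ≢ b → Matrix _
  rest {a} a≢b r c = M (suc (suc r)) (punchIn a (punchIn (punchOut a≢b) c))
  reassoc : ∀ s x y d → - s * (y * (x * d)) ≡ - (s * (x * (y * d)))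
  reassoc = solve-∀

det-swap01 : ∀ {n} (M : Matrix (suc (suc n))) → det (M ∘ swap01) ≡ - det M
det-swap01 M = begin
  det (M ∘ swap01)                                        ≡⟨ det-pairExpand (M ∘ swap01) ⟩
  sum (λ b → sum (λ a → pairExpansion (M ∘ swap01) b a))  ≡⟨ ∑-comm (pairExpansion (M ∘ swap01)) ⟩
  sum (λ a → sum (λ b → pairExpansion (M ∘ swap01) b a))  ≡⟨ sum-cong-≗ (sum-cong-≗ ∘ pairExpansion-swap01 M) ⟩
  sum (λ a → sum (λ b → - pairExpansion M a b))           ≡⟨ sum-cong-≗ (sum-neg ∘ pairExpansion M) ⟩
  sum (λ a → - sum (pairExpansion M a))                   ≡⟨ sum-neg (λ a → sum (pairExpansion M a)) ⟩
  - sum (λ a → sum (pairExpansion M a))                   ≡⟨ cong -_ (det-pairExpand M) ⟨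
  - det M                                                 ∎
  where open ≡-Reasoning

det-lift : ∀ {n} {ρ : Fin n → Fin n} (s : ℤ) → (∀ N → det N ≡ s * det (N ∘ ρ)) →
           ∀ M → det M ≡ s * det (M ∘ lift 1 ρ)
det-lift {ρ = ρ} s hyp M = begin
  det M                                                         ≡⟨ det-expand M ⟩
  sum (λ j → signFin j * M zero j * det (minor j M))            ≡⟨ sum-cong-≗ pull ⟩
  sum (λ j → s * (signFin j * M zero j * det (minor j M ∘ ρ)))  ≡⟨ *-distribˡ-sum s term ⟨
  s * sum term                                                  ≡⟨ cong (s *_) (det-expand (M ∘ lift 1 ρ)) ⟨
  s * det (M ∘ lift 1 ρ)                                        ∎
  where
  open ≡-Reasoning
  term : Fin _ → ℤ
  term j = signFin j * M zero j * det (minor j M ∘ ρ)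
  reorder : ∀ t x d → x * (t * d) ≡ t * (x * d)
  reorder = solve-∀
  pull : ∀ j → signFin j * M zero j * det (minor j M) ≡ s * (signFin j * M zero j * det (minor j M ∘ ρ))
  pull j = trans (cong (signFin j * M zero j *_) (hyp (minor j M))) (reorder s (signFin j * M zero j) (det (minor j M ∘ ρ)))

toFront : ∀ {n} → Fin (suc n) → Fin (suc n) → Fin (suc n)
toFront i zero    = i
toFront i (suc r) = punchIn i r

det-toFront : ∀ {n} (i : Fin (suc n)) (M : Matrix (suc n)) → det M ≡ signFin i * det (M ∘ toFront i)
det-toFront zero M = trans (det-cong unchanged) (sym (ℤ.*-identityˡ (det (M ∘ toFront zero))))
  where
  unchanged : ∀ r c → M r c ≡ M (toFront zero r) c
  unchanged zero    c = refl
  unchanged (suc r) c = refl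
det-toFront {suc n} (suc i) M = begin
  det M                                     ≡⟨ det-lift {ρ = toFront i} (signFin i) (det-toFront i) M ⟩
  signFin i * det (M ∘ lift 1 (toFront i))  ≡⟨ cong (signFin i *_) (det-cong swapped) ⟩
  signFin i * det (N ∘ swap01)              ≡⟨ cong (signFin i *_) (det-swap01 N) ⟩
  signFin i * - det N                       ≡⟨ ℤ.neg-distribʳ-* (signFin i) (det N) ⟨
  - (signFin i * det N)                     ≡⟨ ℤ.neg-distribˡ-* (signFin i) (det N) ⟩
  - signFin i * det N                       ∎
  where
  open ≡-Reasoning
  N = M ∘ toFront (suc i)
  swapped : ∀ r c → M (lift 1 (toFront i) r) c ≡ N (swap01 r) c
  swapped zero          c = refl
  swapped (suc zero)    c = refl
  swapped (suc (suc r)) c = refl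

i≡-i⇒i≡0 : ∀ {i : ℤ} → i ≡ - i → i ≡ + 0
i≡-i⇒i≡0 {+ zero} _ = refl

det-equalAdjacentRows : ∀ {n} (M : Matrix (suc (suc n))) → (∀ c → M zero c ≡ M (suc zero) c) → det M ≡ + 0
det-equalAdjacentRows M row0≡row1 = i≡-i⇒i≡0 (trans (det-cong swapped) (det-swap01 M))
  where
  swapped : ∀ r c → M r c ≡ M (swap01 r) c
  swapped zero          c = row0≡row1 c
  swapped (suc zero)    c = sym (row0≡row1 c)
  swapped (suc (suc r)) c = refl

det-equalRows : ∀ {n} (M : Matrix (suc n)) (i : Fin n) → (∀ c → M zero c ≡ M (suc i) c) → det M ≡ + 0
det-equalRows {suc n} M i row0≡rowi = begin
  det M                                        ≡⟨ det-toFront (suc i) M ⟩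
  signFin (suc i) * det (M ∘ toFront (suc i))  ≡⟨ cong (signFin (suc i) *_)
                                                       (det-equalAdjacentRows (M ∘ toFront (suc i)) (sym ∘ row0≡rowi)) ⟩
  signFin (suc i) * + 0                        ≡⟨ ℤ.*-zeroʳ (signFin (suc i)) ⟩
  + 0                                          ∎
  where open ≡-Reasoning

det-rowCombination : ∀ {n} (M : Matrix (suc n)) (s : Fin (suc n) → ℤ) →
                     (∀ j → sum (λ i → s i * M i j) ≡ + 0) → s zero * det M ≡ + 0
det-rowCombination {n} M s combination≡0 = begin
  s zero * det M                                    ≡⟨ cong (s zero *_) (det-cong unchanged) ⟩
  s zero * det (replaceRow0 (M zero))               ≡⟨ cong (s zero *_) (det-replaceRow0 (M zero)) ⟩
  s zero * L (M zero)                               ≡⟨ ℤ.+-identityʳ _ ⟨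
  s zero * L (M zero) + + 0                         ≡⟨ cong (λ x → s zero * L (M zero) + x) (sum-zero otherRows) ⟨
  sum (λ i → s i * L (M i))                         ≡⟨ ∑-bilinear s M cofactor ⟩
  sum (λ j → sum (λ i → s i * M i j) * cofactor j)  ≡⟨ sum-zero (λ j → cong (_* cofactor j) (combination≡0 j)) ⟩
  + 0                                               ∎
  where
  open ≡-Reasoning
  cofactor : Fin (suc n) → ℤ
  cofactor j = signFin j * det (minor j M)
  L : (Fin (suc n) → ℤ) → ℤ
  L row = sum (λ j → row j * cofactor j)
  replaceRow0 : (Fin (suc n) → ℤ) → Matrix (suc n)
  replaceRow0 row zero    = row
  replaceRow0 row (suc r) = M (suc r)
  unchanged : ∀ r c → M r c ≡ replaceRow0 (M zero) r c
  unchanged zero    c = refl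
  unchanged (suc r) c = refl
  reorder : ∀ s x d → s * x * d ≡ x * (s * d)
  reorder = solve-∀
  det-replaceRow0 : ∀ row → det (replaceRow0 row) ≡ L row
  det-replaceRow0 row = trans (det-expand (replaceRow0 row))
                              (sum-cong-≗ (λ j → reorder (signFin j) (row j) (det (minor j M))))
  otherRows : ∀ i → s (suc i) * L (M (suc i)) ≡ + 0
  otherRows i = trans (cong (s (suc i) *_) (trans (sym (det-replaceRow0 (M (suc i))))
                                                  (det-equalRows (replaceRow0 (M (suc i))) i (λ _ → refl))))
                      (ℤ.*-zeroʳ (s (suc i)))

det-singleEntryColumn : ∀ {n} (M : Matrix (suc n)) (i j : Fin (suc n)) → (∀ i′ → i′ ≢ i → M i′ j ≡ + 0) →
  det M ≡ signFin i * (signFin j * (M i j * det (λ r c → M (punchIn i r) (punchIn j c))))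
det-singleEntryColumn M i j others = begin
  det M                                                           ≡⟨ det-toFront i M ⟩
  signFin i * det N                                               ≡⟨ cong (signFin i *_) (det-expand N) ⟩
  signFin i * sum (λ l → signFin l * N zero l * det (minor l N))  ≡⟨ cong (signFin i *_) (sum-single _ j offColumns) ⟩
  signFin i * (signFin j * M i j * det (minor j N))               ≡⟨ cong (signFin i *_) (ℤ.*-assoc (signFin j) _ _) ⟩
  signFin i * (signFin j * (M i j * det (minor j N)))             ∎
  where
  open ≡-Reasoning
  N = M ∘ toFront i
  offColumns : ∀ l → l ≢ j → signFin l * N zero l * det (minor l N) ≡ + 0
  offColumns l l≢j = trans (cong (signFin l * N zero l *_) (det-zeroColumn (minor l N) (punchOut l≢j) zeroColumn))
                           (ℤ.*-zeroʳ (signFin l * N zero l))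
    where
    zeroColumn : ∀ r → N (suc r) (punchIn l (punchOut l≢j)) ≡ + 0
    zeroColumn r = trans (cong (N (suc r)) (punchIn-punchOut l≢j)) (others _ (punchInᵢ≢i i r))

ZeroOrUnit : ℤ → Set
ZeroOrUnit d = (d ≡ + 0) ⊎ (d ≡ + 1) ⊎ (d ≡ -1ℤ)

ZeroOrUnit-neg : ∀ {d} → ZeroOrUnit d → ZeroOrUnit (- d)
ZeroOrUnit-neg (inj₁ refl)        = inj₁ refl
ZeroOrUnit-neg (inj₂ (inj₁ refl)) = inj₂ (inj₂ refl)
ZeroOrUnit-neg (inj₂ (inj₂ refl)) = inj₂ (inj₁ refl)

ZeroOrUnit-signFin : ∀ {k} (i : Fin k) {d} → ZeroOrUnit d → ZeroOrUnit (signFin i * d)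
ZeroOrUnit-signFin zero    {d} u = subst ZeroOrUnit (sym (ℤ.*-identityˡ d)) u
ZeroOrUnit-signFin (suc i) {d} u =
  subst ZeroOrUnit (ℤ.neg-distribˡ-* (signFin i) d) (ZeroOrUnit-neg (ZeroOrUnit-signFin i u))

-- Signings of graphs without odd closed walks

module _ {N : ℕ} (F : ℕ → Pred (Fin N) 0ℓ) (F? : ∀ L → Decidable (F L)) (F-mono : ∀ L → F L ⊆ F (suc L)) where

  private
    NewAt : ℕ → Set
    NewAt L = ∃ λ x → F (suc L) x × ¬ F L x

    new? : ∀ L → Dec (NewAt L)
    new? L = any? (λ x → F? (suc L) x ×-dec ¬? (F? L x))

    F-mono* : ∀ {m n} → m ≤′ n → F m ⊆ F n
    F-mono* ≤′-refl        = id
    F-mono* (≤′-step m≤n) = F-mono _ ∘ F-mono* m≤n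

  -- If N + 1 consecutive steps all added an element, two of these elements coincide.
  stabilises : ∃ λ L → F (suc L) ⊆ F L
  stabilises with any? (λ (L : Fin (suc N)) → ¬? (new? (toℕ L)))
  ... | yes (L , noneNew) = toℕ L , λ {x} x∈ → decidable-stable (F? (toℕ L) x) (λ x∉ → noneNew (x , x∈ , x∉))
  ... | no alwaysNew =
    let (i , j , i<j , xᵢ≡xⱼ) = pigeonhole (n<1+n N) (proj₁ ∘ new)
    in  contradiction (subst (F (toℕ j)) xᵢ≡xⱼ (F-mono* (≤⇒≤′ i<j) (proj₁ (proj₂ (new i)))))
                      (proj₂ (proj₂ (new j)))
    where
    new : ∀ (L : Fin (suc N)) → NewAt (toℕ L)
    new L = decidable-stable (new? (toℕ L)) (λ ¬new → alwaysNew (L , ¬new))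

-- A walk from (x , p) to (y , q) in the double cover is a walk from x to y
-- whose length has parity p + q.
DoubleCover : ∀ {A : Set} → Rel A 0ℓ → Rel (A × Parity) 0ℓ
DoubleCover R (x , p) (y , q) = R x y × q ≡ p ⁻¹

module _ {A : Set} {R : Rel A 0ℓ} where

  DoubleCover-sym : Symmetric R → Sym (DoubleCover R) (DoubleCover R)
  DoubleCover-sym R-sym (xRy , q≡p⁻¹) = R-sym xRy , sym (⁻¹-selfInverse (sym q≡p⁻¹))

  flipParity : ∀ {x y p q} → Star (DoubleCover R) (x , p) (y , q) → Star (DoubleCover R) (x , p ⁻¹) (y , q ⁻¹)
  flipParity = gmap (map₂ _⁻¹) (map₂ (cong _⁻¹))

  mapDoubleCover : ∀ {B : Set} {S : Rel B 0ℓ} (f : A → B) → (∀ {x y} → R x y → S (f x) (f y)) →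
                   ∀ {x y p q} → Star (DoubleCover R) (x , p) (y , q) → Star (DoubleCover S) (f x , p) (f y , q)
  mapDoubleCover f f-hom = gmap (map₁ f) (map₁ f-hom)

signOf : Parity → ℤ
signOf 0ℙ = + 1
signOf 1ℙ = -1ℤ

signOf-opposite : ∀ p → signOf p + signOf (p ⁻¹) ≡ + 0
signOf-opposite 0ℙ = refl
signOf-opposite 1ℙ = refl

-- The sign of v is ±1 according to the parity of some walk from the root to v,
-- and 0 if there is none.  Walks are found by breadth-first search, which
-- stabilises at some radius L; parities are consistent since there is no odd
-- closed walk.
module _ {k : ℕ} (R : Rel (Fin k) 0ℓ) (R? : ∀ x y → Dec (R x y)) (R-sym : Symmetric R)
         (noOddClosedWalk : ∀ x → ¬ Star (DoubleCover R) (x , 0ℙ) (x , 1ℙ)) (root : Fin k) where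

  private
    WalkFromRoot : Fin k → Parity → Set
    WalkFromRoot v p = Star (DoubleCover R) (root , 0ℙ) (v , p)

    Reach : ℕ → Pred (Fin k) 0ℓ
    Reach zero    v = v ≡ root
    Reach (suc L) v = Reach L v ⊎ ∃ λ u → Reach L u × R u v

    reach? : ∀ L → Decidable (Reach L)
    reach? zero    v = v ≟ root
    reach? (suc L) v = reach? L v ⊎-dec any? (λ u → reach? L u ×-dec R? u v)

    Reach-root : ∀ L → Reach L root
    Reach-root zero    = refl
    Reach-root (suc L) = inj₁ (Reach-root L)

    walkTo : ∀ {L v} → Reach L v → ∃ (WalkFromRoot v)
    walkTo {zero}  refl                 = 0ℙ , ε
    walkTo {suc L} (inj₁ r)             = walkTo r
    walkTo {suc L} (inj₂ (u , r , uRv)) = let (p , w) = walkTo r in p ⁻¹ , w ◅◅ (uRv , refl) ◅ ε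

    root-even : ∀ {p} → WalkFromRoot root p → p ≡ 0ℙ
    root-even {0ℙ} _ = refl
    root-even {1ℙ} w = contradiction w (noOddClosedWalk root)

    oddClosedWalk : ∀ {a b p} → WalkFromRoot a p → WalkFromRoot b p → R a b →
                    Star (DoubleCover R) (root , 0ℙ) (root , 1ℙ)
    oddClosedWalk wa wb aRb = wa ◅◅ (aRb , refl) ◅ flipParity (reverse (DoubleCover-sym {R = R} R-sym) wb)

    adjacent-opposite : ∀ {a b p q} → WalkFromRoot a p → WalkFromRoot b q → R a b → q ≡ p ⁻¹
    adjacent-opposite {p = 0ℙ} {1ℙ} _  _  _   = refl
    adjacent-opposite {p = 1ℙ} {0ℙ} _  _  _   = refl
    adjacent-opposite {p = 0ℙ} {0ℙ} wa wb aRb = contradiction (oddClosedWalk wa wb aRb) (noOddClosedWalk root)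
    adjacent-opposite {p = 1ℙ} {1ℙ} wa wb aRb = contradiction (oddClosedWalk wa wb aRb) (noOddClosedWalk root)

    stable : ∃ λ L → Reach (suc L) ⊆ Reach L
    stable = stabilises Reach reach? (λ _ → inj₁)

    L = proj₁ stable

    Reach-closed : ∀ {a b} → Reach L a → R a b → Reach L b
    Reach-closed ra aRb = proj₂ stable (inj₂ (_ , ra , aRb))

    signFrom : ∀ {v} → Dec (Reach L v) → ℤ
    signFrom (yes r) = signOf (proj₁ (walkTo r))
    signFrom (no _)  = + 0

    sign : Fin k → ℤ
    sign v = signFrom (reach? L v)

    sign-root : sign root ≡ + 1
    sign-root with reach? L root
    ... | yes r = cong signOf (root-even (proj₂ (walkTo r)))
    ... | no ¬r = contradiction (Reach-root L) ¬r

    sign-adjacent : ∀ {a b} → R a b → sign a + sign b ≡ + 0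
    sign-adjacent {a} {b} aRb with reach? L a | reach? L b
    ... | yes ra | yes rb = trans (cong (λ q → signOf (proj₁ (walkTo ra)) + signOf q)
                                        (adjacent-opposite (proj₂ (walkTo ra)) (proj₂ (walkTo rb)) aRb))
                                  (signOf-opposite (proj₁ (walkTo ra)))
    ... | yes ra | no ¬rb = contradiction (Reach-closed ra aRb) ¬rb
    ... | no ¬ra | yes rb = contradiction (Reach-closed rb (R-sym aRb)) ¬ra
    ... | no _   | no _   = refl

  signing : ∃ λ (s : Fin k → ℤ) → s root ≡ + 1 × (∀ {a b} → R a b → s a + s b ≡ + 0)
  signing = sign , sign-root , sign-adjacent

module _ {n : ℕ} {e : Subset n} where

  IsTwoPartition-sym : ∀ {S T} → IsTwoPartition e S T → IsTwoPartition e T S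
  IsTwoPartition-sym {S} {T} (S≢∅ , T≢∅ , S∩T≡⊥ , S∪T≡e) =
    T≢∅ , S≢∅ , trans (∩-comm T S) S∩T≡⊥ , trans (∪-comm T S) S∪T≡e

  IsTwoPartition-≢ : ∀ {S T} → IsTwoPartition e S T → S ≢ T
  IsTwoPartition-≢ {S} ((x , x∈S) , _ , S∩S≡⊥ , _) refl =
    ∉⊥ (subst (x Subset.∈_) (trans (sym (∩-idem S)) S∩S≡⊥) x∈S)

  IsTwoPartition-unique : ∀ {S S′ T} → IsTwoPartition e S T → IsTwoPartition e S′ T → S ≡ S′
  IsTwoPartition-unique {S} {S′} {T} (_ , _ , S∩T≡⊥ , S∪T≡e) (_ , _ , S′∩T≡⊥ , S′∪T≡e) = begin
    S       ≡⟨ A≡A∩A′ S∩T≡⊥ S∪T≡e S′∪T≡e ⟩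
    S ∩ S′  ≡⟨ ∩-comm S S′ ⟩
    S′ ∩ S  ≡⟨ A≡A∩A′ S′∩T≡⊥ S′∪T≡e S∪T≡e ⟨
    S′      ∎
    where
    open ≡-Reasoning
    A≡A∩A′ : ∀ {A A′} → A ∩ T ≡ Subset.⊥ → A ∪ T ≡ e → A′ ∪ T ≡ e → A ≡ A ∩ A′
    A≡A∩A′ {A} {A′} A∩T≡⊥ A∪T≡e A′∪T≡e = begin
      A                  ≡⟨ ∩-abs-∪ A T ⟨
      A ∩ (A ∪ T)        ≡⟨ cong (A ∩_) (trans A∪T≡e (sym A′∪T≡e)) ⟩
      A ∩ (A′ ∪ T)       ≡⟨ ∩-distribˡ-∪ A A′ T ⟩
      A ∩ A′ ∪ A ∩ T     ≡⟨ cong (A ∩ A′ ∪_) A∩T≡⊥ ⟩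
      A ∩ A′ ∪ Subset.⊥  ≡⟨ ∪-identityʳ (A ∩ A′) ⟩
      A ∩ A′             ∎

_≟ˢ_ : ∀ {n} → DecidableEquality (Subset n)
_≟ˢ_ = ≡-dec Bool._≟_

B-entry-part : ∀ {n} {S T₁ T₂ : Subset n} → S ≡ T₁ ⊎ S ≡ T₂ → B-entry S (T₁ , T₂) ≡ + 1
B-entry-part {S = S} {T₁} {T₂} S∈T with S ≟ˢ T₁ ⊎-dec S ≟ˢ T₂
... | yes _   = refl
... | no S∉T = contradiction S∈T S∉T

B-entry-nonpart : ∀ {n} {S T₁ T₂ : Subset n} → S ≢ T₁ → S ≢ T₂ → B-entry S (T₁ , T₂) ≡ + 0
B-entry-nonpart {S = S} {T₁} {T₂} S≢T₁ S≢T₂ with S ≟ˢ T₁ ⊎-dec S ≟ˢ T₂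
... | yes (inj₁ S≡T₁) = contradiction S≡T₁ S≢T₁
... | yes (inj₂ S≡T₂) = contradiction S≡T₂ S≢T₂
... | no _            = refl

-- Odd closed exact walks

parity-suc : ∀ n → parity (suc n) ≡ parity n ⁻¹
parity-suc n = sym (⁻¹-selfInverse (suc-homo-⁻¹ n))

parity-split : ∀ a b → parity (a ℕ.+ b) ≡ 1ℙ → parity a ≡ 1ℙ ⊎ parity b ≡ 1ℙ
parity-split a b odd with parity a | parity b | +-homo-+ a b
... | 1ℙ | _  | _  = inj₁ refl
... | 0ℙ | 1ℙ | _  = inj₂ refl
... | 0ℙ | 0ℙ | eq = contradiction (trans (sym eq) odd) λ ()

parity⇒IsOdd : ∀ n → parity n ≡ 1ℙ → IsOdd n
parity⇒IsOdd zero          ()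
parity⇒IsOdd 1             _   = 0 , refl
parity⇒IsOdd (suc (suc n)) odd =
  let (m , n≡1+2m) = parity⇒IsOdd n odd in suc m , cong suc (trans (cong suc n≡1+2m) (sym (*-suc 2 m)))

[1+m]%n≡[1+m%n]%n : ∀ m n .{{_ : NonZero n}} → suc m % n ≡ suc (m % n) % n
[1+m]%n≡[1+m%n]%n m n = begin
  (1 ℕ.+ m) % n              ≡⟨ %-distribˡ-+ 1 m n ⟩
  (1 % n ℕ.+ m % n) % n      ≡⟨ cong (λ x → (1 % n ℕ.+ x) % n) (m%n%n≡m%n m n) ⟨
  (1 % n ℕ.+ m % n % n) % n  ≡⟨ %-distribˡ-+ 1 (m % n) n ⟨
  (1 ℕ.+ m % n) % n          ∎
  where open ≡-Reasoning

module ExactSequences (H : Hypergraph) where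

  ExactStep : Rel (Subset (nV H)) 0ℓ
  ExactStep S T = Inτ H (S , T)

  StepVia : (e S T : Subset (nV H)) → Set
  StepVia e S T = e ∈ E H × IsTwoPartition e S T

  -- S t and e t are the parts and edges of a walk S 0 , e 0 , S 1 , … , S n;
  -- their values beyond n are irrelevant.
  ExactSteps : ℕ → (S e : ℕ → Subset (nV H)) → Set
  ExactSteps n S e = ∀ t → t < n → StepVia (e t) (S t) (S (suc t))

  ExactSteps∞ : (S e : ℕ → Subset (nV H)) → Set
  ExactSteps∞ S e = ∀ t → StepVia (e t) (S t) (S (suc t))

  record ExactSequence : Set where
    field
      length      : ℕ
      parts edges : ℕ → Subset (nV H)
      steps       : ExactSteps length parts edges

  open ExactSequence

  prepend : ∀ {e S} (w : ExactSequence) → StepVia e S (parts w 0) → ExactSequence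
  prepend {e} {S} w first = record
    { length = suc (length w)
    ; parts  = λ { zero → S ; (suc t) → parts w t }
    ; edges  = λ { zero → e ; (suc t) → edges w t }
    ; steps  = λ { zero _ → first ; (suc t) t<n → steps w t (s≤s⁻¹ t<n) }
    }

  fromStar : ∀ {S T p q} → Star (DoubleCover ExactStep) (S , p) (T , q) →
             Σ ExactSequence λ w → parts w 0 ≡ S × parts w (length w) ≡ T × parity (length w) ≡ p +ℙ q
  fromStar {S} {p = p} ε = record { length = 0 ; parts = λ _ → S ; edges = λ _ → S ; steps = λ _ () } ,
                           refl , refl , sym (p+p≡0ℙ p)
  fromStar {p = p} {q} (((e , first) , p′≡p⁻¹) ◅ rest) =
    let (w , w₀≡ , wₙ≡T , parity≡) = fromStar rest
    in  prepend w (subst (StepVia e _) (sym w₀≡) first) , refl , wₙ≡T , (begin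
          parity (suc (length w))  ≡⟨ parity-suc (length w) ⟩
          parity (length w) ⁻¹     ≡⟨ cong _⁻¹ (trans parity≡ (cong (_+ℙ q) p′≡p⁻¹)) ⟩
          (p ⁻¹ +ℙ q) ⁻¹           ≡⟨ flip-+ p ⟩
          p +ℙ q                   ∎)
    where
    open ≡-Reasoning
    flip-+ : ∀ p → (p ⁻¹ +ℙ q) ⁻¹ ≡ p +ℙ q
    flip-+ 0ℙ = ⁻¹-involutive q
    flip-+ 1ℙ = refl

  segment : ∀ {S e} → ExactSteps∞ S e → ∀ a d → ExactSteps d (λ x → S (a ℕ.+ x)) (λ x → e (a ℕ.+ x))
  segment {S} {e} steps a d t _ = subst (StepVia (e (a ℕ.+ t)) (S (a ℕ.+ t)) ∘ S) (sym (+-suc a t)) (steps (a ℕ.+ t))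

  periodic : ∀ {n S e} .{{_ : NonZero n}} → ExactSteps n S e → S n ≡ S 0 →
             ExactSteps∞ (λ x → S (x % n)) (λ x → e (x % n))
  periodic {n} {S} {e} steps closed t = subst (StepVia (e (t % n)) (S (t % n))) wrap (steps (t % n) (m%n<n t n))
    where
    S-mod : ∀ x → x ≤ n → S x ≡ S (x % n)
    S-mod x x≤n with m≤n⇒m<n∨m≡n x≤n
    ... | inj₁ x<n  = cong S (sym (m<n⇒m%n≡m x<n))
    ... | inj₂ refl = trans closed (cong S (sym (n%n≡0 n)))
    wrap : S (suc (t % n)) ≡ S (suc t % n)
    wrap = trans (S-mod (suc (t % n)) (m%n<n t n)) (cong S (sym ([1+m]%n≡[1+m%n]%n t n)))

  Distinct : ℕ → (ℕ → Subset (nV H)) → Set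
  Distinct n S = ∀ {a b} → a < n → b < n → S a ≡ S b → a ≡ b

  toExactWalk : ∀ {n S e} → ExactSteps n S e → ExactWalk H
  toExactWalk {n} {S} {e} steps = record
    { len   = n
    ; part  = S ∘ toℕ
    ; edge  = e ∘ toℕ
    ; edge∈ = λ i → proj₁ (steps (toℕ i) (toℕ<n i))
    ; step  = λ i → subst (λ x → IsTwoPartition (e (toℕ i)) (S x) (S (suc (toℕ i))))
                          (sym (toℕ-inject₁ i)) (proj₂ (steps (toℕ i) (toℕ<n i)))
    }

  module SimpleClosedWalk {m S e} (steps : ExactSteps (3 ℕ.+ m) S e) (closed : S (3 ℕ.+ m) ≡ S 0)
                          (distinct : Distinct (3 ℕ.+ m) S) where

    private
      n = 3 ℕ.+ m

    skip-next : ∀ t → suc t < n → e t ≡ e (suc t) → S t ≡ S (suc (suc t))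
    skip-next t t+1<n eₜ≡eₜ₊₁ = IsTwoPartition-unique (proj₂ (steps t (<-trans (n<1+n t) t+1<n)))
      (subst (λ x → IsTwoPartition x _ _) (sym eₜ≡eₜ₊₁) (IsTwoPartition-sym (proj₂ (steps (suc t) t+1<n))))

    consecutive-differ : ∀ t → suc t < n → e t ≢ e (suc t)
    consecutive-differ t t+1<n eₜ≡eₜ₊₁ with m≤n⇒m<n∨m≡n t+1<n
    ... | inj₁ t+2<n =
      <⇒≢ (m<n⇒m<1+n (n<1+n t)) (distinct (<-trans (n<1+n t) t+1<n) t+2<n (skip-next t t+1<n eₜ≡eₜ₊₁))
    ... | inj₂ t+2≡n with distinct (<-trans (n<1+n t) t+1<n) (s≤s z≤n)
                                   (trans (skip-next t t+1<n eₜ≡eₜ₊₁) (trans (cong S t+2≡n) closed))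
    ...   | refl = contradiction t+2≡n λ ()

    last-differs-first : e (2 ℕ.+ m) ≢ e 0
    last-differs-first eₗ≡e₀ = contradiction (distinct (n<1+n _) (s≤s (s≤s z≤n)) Sₗ≡S₁) λ ()
      where
      Sₗ≡S₁ : S (2 ℕ.+ m) ≡ S 1
      Sₗ≡S₁ = IsTwoPartition-unique
        (subst (λ x → IsTwoPartition x _ _) eₗ≡e₀
               (subst (IsTwoPartition _ _) closed (proj₂ (steps (2 ℕ.+ m) (n<1+n _)))))
        (IsTwoPartition-sym (proj₂ (steps 0 (s≤s z≤n))))

    pick : Parity → Subset (nV H)
    pick 0ℙ = e 0
    pick 1ℙ = e 1

    alternating : (∀ t → t < n → e t ≡ e 0 ⊎ e t ≡ e 1) → ∀ t → t < n → e t ≡ pick (parity t)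
    alternating twoEdges zero    _     = refl
    alternating twoEdges (suc t) t+1<n =
      trans (other (parity t) (twoEdges (suc t) t+1<n) differs) (cong pick (sym (parity-suc t)))
      where
      differs : e (suc t) ≢ pick (parity t)
      differs eq = consecutive-differ t t+1<n (trans (alternating twoEdges t (<-trans (n<1+n t) t+1<n)) (sym eq))
      other : ∀ p {x} → x ≡ e 0 ⊎ x ≡ e 1 → x ≢ pick p → x ≡ pick (p ⁻¹)
      other 0ℙ (inj₁ x≡e₀) x≢e₀ = contradiction x≡e₀ x≢e₀
      other 0ℙ (inj₂ x≡e₁) _    = x≡e₁
      other 1ℙ (inj₁ x≡e₀) _    = x≡e₀
      other 1ℙ (inj₂ x≡e₁) x≢e₁ = contradiction x≡e₁ x≢e₁

    -- With only two edges, consecutive edges differing forces them to alternate,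
    -- so the last edge, at the even index n - 1, would equal the first.
    threeEdges : parity n ≡ 1ℙ → ∃ λ (i : Fin n) → ∃ λ (j : Fin n) → ∃ λ (l : Fin n) →
                 e (toℕ i) ≢ e (toℕ j) × e (toℕ i) ≢ e (toℕ l) × e (toℕ j) ≢ e (toℕ l)
    threeEdges odd with anyUpTo? (λ l → ¬? (e l ≟ˢ e 0) ×-dec ¬? (e l ≟ˢ e 1)) n
    ... | yes (l , l<n , eₗ≢e₀ , eₗ≢e₁) =
      zero , suc zero , fromℕ< l<n , consecutive-differ 0 (s≤s (s≤s z≤n)) ,
      (λ eq → eₗ≢e₀ (sym (trans eq (cong e (toℕ-fromℕ< l<n))))) ,
      (λ eq → eₗ≢e₁ (sym (trans eq (cong e (toℕ-fromℕ< l<n)))))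
    ... | no noThird =
      contradiction (trans (alternating twoEdges (2 ℕ.+ m) (n<1+n _)) (cong pick evenLast)) last-differs-first
      where
      twoEdges : ∀ t → t < n → e t ≡ e 0 ⊎ e t ≡ e 1
      twoEdges t t<n with e t ≟ˢ e 0 | e t ≟ˢ e 1
      ... | yes eₜ≡e₀ | _         = inj₁ eₜ≡e₀
      ... | no _      | yes eₜ≡e₁ = inj₂ eₜ≡e₁
      ... | no eₜ≢e₀  | no eₜ≢e₁  = contradiction (t , t<n , eₜ≢e₀ , eₜ≢e₁) noThird
      evenLast : parity m ≡ 0ℙ
      evenLast = sym (⁻¹-selfInverse (trans (sym (parity-suc m)) odd))

  oddExactCycle : ∀ {n S e} (steps : ExactSteps n S e) → S n ≡ S 0 → Distinct n S → parity n ≡ 1ℙ →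
                  IsExactCycle (toExactWalk steps) × IsOdd n
  oddExactCycle {zero} _ _ _ ()
  oddExactCycle {1} steps closed _ _ = contradiction (sym closed) (IsTwoPartition-≢ (proj₂ (steps 0 (s≤s z≤n))))
  oddExactCycle {2} _ _ _ ()
  oddExactCycle {suc (suc (suc m))} {S} steps closed distinct odd =
    (SimpleClosedWalk.threeEdges steps closed distinct odd ,
     trans (sym closed) (cong S (sym (toℕ-fromℕ _))) ,
     λ i j _ i<n _ j<n Sᵢ≡Sⱼ → toℕ-injective (distinct i<n j<n Sᵢ≡Sⱼ)) ,
    parity⇒IsOdd _ odd

  NoOddClosed : ℕ → Set
  NoOddClosed n = ∀ {S e} → ExactSteps n S e → S n ≡ S 0 → parity n ≡ 1ℙ → ⊥

  -- The parts S s = S t cut the closed walk, run around periodically, into the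
  -- closed segments [s , t] and [t , s + n]; their lengths add up to n, so one is odd.
  splitAtRepeat : ∀ {n} .{{_ : NonZero n}} → (∀ {m} → m < n → NoOddClosed m) →
                  ∀ {S e s t} → ExactSteps n S e → S n ≡ S 0 → parity n ≡ 1ℙ →
                  s < t → t < n → S s ≡ S t → ⊥
  splitAtRepeat {n} shorter {S} {s = s} {t} steps closed odd s<t t<n Sₛ≡Sₜ =
    [ closedSegment s d innerClosed d<n , closedSegment t (n ∸ d) outerClosed n∸d<n ]′
      (parity-split d (n ∸ d) (trans (cong parity d+[n∸d]≡n) odd))
    where
    open ≡-Reasoning
    S′ : ℕ → Subset (nV H)
    S′ x = S (x % n)
    d = t ∸ s
    s+d≡t : s ℕ.+ d ≡ t
    s+d≡t = m+[n∸m]≡n (<⇒≤ s<t)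
    d<n : d < n
    d<n = ≤-<-trans (m∸n≤m t s) t<n
    d+[n∸d]≡n : d ℕ.+ (n ∸ d) ≡ n
    d+[n∸d]≡n = m+[n∸m]≡n (<⇒≤ d<n)
    n∸d<n : n ∸ d < n
    n∸d<n = ∸-monoʳ-< (m<n⇒0<n∸m s<t) (<⇒≤ d<n)
    S′≡S : ∀ {x} → x < n → S′ x ≡ S x
    S′≡S x<n = cong S (m<n⇒m%n≡m x<n)
    closedSegment : ∀ a l → S′ (a ℕ.+ l) ≡ S′ a → l < n → parity l ≡ 1ℙ → ⊥
    closedSegment a l closedₐ l<n =
      shorter l<n (segment (periodic steps closed) a l) (trans closedₐ (cong S′ (sym (+-identityʳ a))))
    innerClosed : S′ (s ℕ.+ d) ≡ S′ s
    innerClosed = begin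
      S′ (s ℕ.+ d)  ≡⟨ cong S′ s+d≡t ⟩
      S′ t          ≡⟨ S′≡S t<n ⟩
      S t           ≡⟨ Sₛ≡Sₜ ⟨
      S s           ≡⟨ S′≡S (<-trans s<t t<n) ⟨
      S′ s          ∎
    outerClosed : S′ (t ℕ.+ (n ∸ d)) ≡ S′ t
    outerClosed = begin
      S′ (t ℕ.+ (n ∸ d))        ≡⟨ cong (λ x → S′ (x ℕ.+ (n ∸ d))) s+d≡t ⟨
      S′ (s ℕ.+ d ℕ.+ (n ∸ d))  ≡⟨ cong S′ (trans (+-assoc s d (n ∸ d)) (cong (s ℕ.+_) d+[n∸d]≡n)) ⟩
      S′ (s ℕ.+ n)              ≡⟨ cong S ([m+n]%n≡m%n s n) ⟩
      S′ s                      ≡⟨ S′≡S (<-trans s<t t<n) ⟩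
      S s                       ≡⟨ Sₛ≡Sₜ ⟩
      S t                       ≡⟨ S′≡S t<n ⟨
      S′ t                      ∎

  noOddClosedSequence : NoOddExactCycle H → ∀ n → NoOddClosed n
  noOddClosedSequence noOddCycle = <-rec NoOddClosed reduce
    where
    reduce : ∀ n → (∀ {m} → m < n → NoOddClosed m) → NoOddClosed n
    reduce zero _ _ _ ()
    reduce n@(suc _) shorter {S} steps closed odd with anyUpTo? (λ t → anyUpTo? (λ s → S s ≟ˢ S t) t) n
    ... | yes (t , t<n , s , s<t , Sₛ≡Sₜ) = splitAtRepeat shorter steps closed odd s<t t<n Sₛ≡Sₜ
    ... | no noRepeat = noOddCycle (toExactWalk steps) (oddExactCycle steps closed distinct odd)
      where
      distinct : Distinct n S
      distinct {a} {b} a<n b<n Sₐ≡S_b with <-cmp a b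
      ... | tri< a<b _ _ = contradiction (b , b<n , a , a<b , Sₐ≡S_b) noRepeat
      ... | tri≈ _ a≡b _ = a≡b
      ... | tri> _ _ b<a = contradiction (a , a<n , b , b<a , sym Sₐ≡S_b) noRepeat

  noOddClosedExactWalk : NoOddExactCycle H → ∀ S → ¬ Star (DoubleCover ExactStep) (S , 0ℙ) (S , 1ℙ)
  noOddClosedExactWalk noOddCycle S walk =
    let (w , w₀≡S , wₙ≡S , odd) = fromStar walk
    in  noOddClosedSequence noOddCycle (length w) (steps w) (trans wₙ≡S (sym w₀≡S)) odd

-- Square submatrices of B(H)

module Submatrix {H : Hypergraph} {n : ℕ} (r : Fin (suc n) → Subset (nV H)) (c : Fin (suc n) → UPair (nV H))
                 (r-injective : ∀ i i′ → r i ≡ r i′ → i ≡ i′) (c∈τ : ∀ j → Inτ H (c j)) where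

  open ExactSequences H

  M : Matrix (suc n)
  M i j = B-entry (r i) (c j)

  other-row : ∀ {i a T} → r a ≡ T → i ≢ a → r i ≢ T
  other-row rₐ≡T i≢a rᵢ≡T = i≢a (r-injective _ _ (trans rᵢ≡T (sym rₐ≡T)))

  Covered : Fin (suc n) → Set
  Covered j = (∃ λ a → r a ≡ proj₁ (c j)) × (∃ λ b → r b ≡ proj₂ (c j))

  covered? : ∀ j → Dec (Covered j)
  covered? j = any? (λ a → r a ≟ˢ proj₁ (c j)) ×-dec any? (λ b → r b ≟ˢ proj₂ (c j))

  uncovered-sparse : ∀ j → ¬ Covered j →
                     (∀ i → M i j ≡ + 0) ⊎ ∃ λ i → M i j ≡ + 1 × (∀ i′ → i′ ≢ i → M i′ j ≡ + 0)
  uncovered-sparse j uncovered with any? (λ a → r a ≟ˢ proj₁ (c j)) | any? (λ b → r b ≟ˢ proj₂ (c j))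
  ... | yes first     | yes second     = contradiction (first , second) uncovered
  ... | yes (a , rₐ≡) | no ¬second     =
    inj₂ (a , B-entry-part (inj₁ rₐ≡) , λ i i≢a → B-entry-nonpart (other-row rₐ≡ i≢a) (¬second ∘ (i ,_)))
  ... | no ¬first     | yes (b , r_b≡) =
    inj₂ (b , B-entry-part (inj₂ r_b≡) , λ i i≢b → B-entry-nonpart (¬first ∘ (i ,_)) (other-row r_b≡ i≢b))
  ... | no ¬first     | no ¬second     = inj₁ (λ i → B-entry-nonpart (¬first ∘ (i ,_)) (¬second ∘ (i ,_)))

  RowAdj : Rel (Fin (suc n)) 0ℓ
  RowAdj a b = ∃ λ j → c j ≡ (r a , r b) ⊎ c j ≡ (r b , r a)

  rowAdj? : ∀ a b → Dec (RowAdj a b)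
  rowAdj? a b = any? (λ j → (c j ≟ᵖ (r a , r b)) ⊎-dec (c j ≟ᵖ (r b , r a)))
    where _≟ᵖ_ = Product.≡-dec _≟ˢ_ _≟ˢ_

  RowAdj-sym : Symmetric RowAdj
  RowAdj-sym (j , cⱼ≡) = j , Sum.swap cⱼ≡

  RowAdj⇒ExactStep : ∀ {a b} → RowAdj a b → ExactStep (r a) (r b)
  RowAdj⇒ExactStep (j , inj₁ cⱼ≡) = subst (Inτ H) cⱼ≡ (c∈τ j)
  RowAdj⇒ExactStep (j , inj₂ cⱼ≡) =
    let (e , e∈E , partition) = subst (Inτ H) cⱼ≡ (c∈τ j) in e , e∈E , IsTwoPartition-sym partition

  det-signedRows : (s : Fin (suc n) → ℤ) → s zero ≡ + 1 → (∀ {a b} → RowAdj a b → s a + s b ≡ + 0) →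
                   (∀ j → Covered j) → det M ≡ + 0
  det-signedRows s s₀≡1 s-adjacent allCovered = begin
    det M           ≡⟨ ℤ.*-identityˡ (det M) ⟨
    + 1 * det M     ≡⟨ cong (_* det M) s₀≡1 ⟨
    s zero * det M  ≡⟨ det-rowCombination M s columnSum ⟩
    + 0             ∎
    where
    open ≡-Reasoning
    columnSum : ∀ j → sum (λ i → s i * M i j) ≡ + 0
    columnSum j with allCovered j
    ... | (a , rₐ≡) , (b , r_b≡) = begin
      sum (λ i → s i * M i j)    ≡⟨ sum-pair (λ i → s i * M i j) a≢b others ⟩
      s a * M a j + s b * M b j  ≡⟨ cong₂ (λ x y → s a * x + s b * y)
                                          (B-entry-part (inj₁ rₐ≡)) (B-entry-part (inj₂ r_b≡)) ⟩
      s a * + 1 + s b * + 1      ≡⟨ cong₂ _+_ (ℤ.*-identityʳ (s a)) (ℤ.*-identityʳ (s b)) ⟩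
      s a + s b                  ≡⟨ s-adjacent (j , inj₁ (cong₂ _,_ (sym rₐ≡) (sym r_b≡))) ⟩
      + 0                        ∎
      where
      a≢b : a ≢ b
      a≢b refl = IsTwoPartition-≢ (proj₂ (proj₂ (c∈τ j))) (trans (sym rₐ≡) r_b≡)
      others : ∀ i → i ≢ a → i ≢ b → s i * M i j ≡ + 0
      others i i≢a i≢b = trans (cong (s i *_) (B-entry-nonpart (other-row rₐ≡ i≢a) (other-row r_b≡ i≢b)))
                               (ℤ.*-zeroʳ (s i))

  det-allCovered : NoOddExactCycle H → (∀ j → Covered j) → det M ≡ + 0
  det-allCovered noOddCycle =
    let (s , s₀≡1 , s-adjacent) = signing RowAdj rowAdj? RowAdj-sym noOddRowWalk zero
    in  det-signedRows s s₀≡1 s-adjacent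
    where
    noOddRowWalk : ∀ a → ¬ Star (DoubleCover RowAdj) (a , 0ℙ) (a , 1ℙ)
    noOddRowWalk a walk = noOddClosedExactWalk noOddCycle (r a) (mapDoubleCover r RowAdj⇒ExactStep walk)

  det-ZeroOrUnit : NoOddExactCycle H → (∀ i j → ZeroOrUnit (det (λ a b → M (punchIn i a) (punchIn j b)))) →
                   ZeroOrUnit (det M)
  det-ZeroOrUnit noOddCycle minors with all? covered?
  ... | yes allCovered   = inj₁ (det-allCovered noOddCycle allCovered)
  ... | no notAllCovered = let (j , uncovered) = ¬∀⟶∃¬ _ Covered covered? notAllCovered in sparse j uncovered
    where
    sparse : ∀ j → ¬ Covered j → ZeroOrUnit (det M)
    sparse j uncovered with uncovered-sparse j uncovered
    ... | inj₁ zeroColumn            = inj₁ (det-zeroColumn M j zeroColumn)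
    ... | inj₂ (i , Mᵢⱼ≡1 , others) =
      subst ZeroOrUnit (sym (det-singleEntryColumn M i j others)) (ZeroOrUnit-signFin i (ZeroOrUnit-signFin j unitMinor))
      where
      D = det (λ a b → M (punchIn i a) (punchIn j b))
      unitMinor : ZeroOrUnit (M i j * D)
      unitMinor = subst (λ x → ZeroOrUnit (x * D)) (sym Mᵢⱼ≡1)
                        (subst ZeroOrUnit (sym (ℤ.*-identityˡ D)) (minors i j))

B-submatrix-ZeroOrUnit : ∀ {H} → NoOddExactCycle H →
                         ∀ k (r : Fin k → Subset (nV H)) (c : Fin k → UPair (nV H)) →
                         (∀ i i′ → r i ≡ r i′ → i ≡ i′) → (∀ j → Inτ H (c j)) →
                         ZeroOrUnit (det (λ i j → B-entry (r i) (c j)))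
B-submatrix-ZeroOrUnit noOddCycle zero    r c _           _   = inj₂ (inj₁ refl)
B-submatrix-ZeroOrUnit noOddCycle (suc k) r c r-injective c∈τ =
  Submatrix.det-ZeroOrUnit r c r-injective c∈τ noOddCycle minors
  where
  minors : ∀ i j → ZeroOrUnit (det (λ a b → B-entry (r (punchIn i a)) (c (punchIn j b))))
  minors i j = B-submatrix-ZeroOrUnit noOddCycle k (r ∘ punchIn i) (c ∘ punchIn j)
                 (λ a a′ eq → punchIn-injective i a a′ (r-injective _ _ eq)) (c∈τ ∘ punchIn j)

mainTheorem10 : (H : Hypergraph) → Simple H → NoOddExactCycle H → BTotallyUnimodular H
mainTheorem10 H _ noOddCycle k r c _ c∈τ r-injective _ = B-submatrix-ZeroOrUnit noOddCycle k r c r-injective c∈τ
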